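{- $\mathrm{DL}\oplus_{\mathrm{JL}}\mathrm{LP}$ is complete with respect to its modular models: for every formula $\varphi$, if $\mathrm{DL}\oplus_{\mathrm{JL}}\mathrm{LP}\nvdash\varphi$, then there is a modular model of $\mathrm{DL}\oplus_{\mathrm{JL}}\mathrm{LP}$ in which $\varphi$ is false.
   Context: Justification constants and variables carry a sign: $c_i^\sigma, x_i^\sigma$ with $\sigma\in\{+,-\}$. Terms of sign $\sigma$: $t^\sigma ::= c_i^\sigma\mid x_j^\sigma\mid[t^\sigma+t^\sigma]\mid[t^\sigma\cdot t^\sigma]$, additionally $[t^-\otimes t^-]$ is a negative term and $!t^+$ is a positive term; $\mathbf{Tm}=\mathbf{Tm}^+\cup\mathbf{Tm}^-$. Formulas ($\mathbf{Fm}$): $A::=\bot\mid A_i\mid (A\wedge A)\mid(A\vee A)\mid(A\to A)\mid\lnot A\mid t^+:A\mid t^-:A$, $A_i\in\mathbf{Var}$. The system $\mathrm{DL}\oplus_{\mathrm{JL}}\mathrm{LP}$ has axioms: classical propositional axioms; Application $s^\sigma:(P\to Q)\to(t^\sigma:P\to[s^\sigma\cdot t^\sigma]:Q)$; Sum $s^\sigma:P\to[s^\sigma+t^\sigma]:P$, $t^\sigma:P\to[s^\sigma+t^\sigma]:P$ (same sign); Denial $s^-:P\to\lnot P$; Pairing $(s^-:P\wedge t^-:Q)\to[s^-\otimes t^-]:(P\wedge Q)$; Positive Factivity $t^+:P\to P$; Positive Introspection $t^+:P\to\,!t^+:(t^+:P)$; rule modus ponens. With $X\cdot Y=\{Q:(P\to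 Q)\in X,P\in Y\}$ and $X\otimes Y=\{P\wedge Q:P\in X,Q\in Y\}$, a modular model is a pair of maps $*:\mathbf{Var}\to\{0,1\}$, $*:\mathbf{Tm}\to\mathcal P(\mathbf{Fm})$ such that, evaluating formulas classically on connectives ($\bot$ false) and $t:P$ true iff $P\in t^*$: $(s^\sigma)^*\cdot(t^\sigma)^*\subseteq[s^\sigma\cdot t^\sigma]^*$; $(s^\sigma)^*\cup(t^\sigma)^*\subseteq[s^\sigma+t^\sigma]^*$; $(s^-)^*\otimes(t^-)^*\subseteq[s^-\otimes t^-]^*$; every formula in $(t^-)^*$ is false; every formula in $(t^+)^*$ is true; and $P\in(t^+)^*$ implies $t^+:P\in(!t^+)^*$. -}

module Defs where

open import Data.Nat using (ℕ)
open import Data.Bool using (Bool; true; false; _∧_; _∨_; not)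
open import Relation.Binary.PropositionalEquality using (_≡_)

data Sign : Set where
  pos neg : Sign

data Tm : Sign → Set where
  con  : ∀ {σ} → ℕ → Tm σ
  tvar : ∀ {σ} → ℕ → Tm σ
  _⊕_  : ∀ {σ} → Tm σ → Tm σ → Tm σ
  _·_  : ∀ {σ} → Tm σ → Tm σ → Tm σ
  _⊗_  : Tm neg → Tm neg → Tm neg
  !_   : Tm pos → Tm pos

infixr 6 _⇒_
data Fm : Set where
  ⊥'   : Fm
  var  : ℕ → Fm
  _∧'_ : Fm → Fm → Fm
  _∨'_ : Fm → Fm → Fm
  _⇒_  : Fm → Fm → Fm
  ¬'_  : Fm → Fm
  _∶_  : ∀ {σ} → Tm σ → Fm → Fm

-- Classical evaluation, with atoms (propositional variables and
-- justification formulas t:A) interpreted by an arbitrary valuation.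
evalP : (Fm → Bool) → Fm → Bool
evalP v ⊥'        = false
evalP v (var i)   = v (var i)
evalP v (A ∧' B)  = evalP v A ∧ evalP v B
evalP v (A ∨' B)  = evalP v A ∨ evalP v B
evalP v (A ⇒ B)   = not (evalP v A) ∨ evalP v B
evalP v (¬' A)    = not (evalP v A)
evalP v (t ∶ A)   = v (t ∶ A)

Tautology : Fm → Set
Tautology A = (v : Fm → Bool) → evalP v A ≡ true

data ⊢_ : Fm → Set where
  taut   : ∀ {A} → Tautology A → ⊢ A
  appl   : ∀ {σ} (s t : Tm σ) (P Q : Fm) → ⊢ ((s ∶ (P ⇒ Q)) ⇒ ((t ∶ P) ⇒ ((s · t) ∶ Q)))
  sumˡ   : ∀ {σ} (s t : Tm σ) (P : Fm) → ⊢ ((s ∶ P) ⇒ ((s ⊕ t) ∶ P))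
  sumʳ   : ∀ {σ} (s t : Tm σ) (P : Fm) → ⊢ ((t ∶ P) ⇒ ((s ⊕ t) ∶ P))
  denial : (s : Tm neg) (P : Fm) → ⊢ ((s ∶ P) ⇒ (¬' P))
  pairing : (s t : Tm neg) (P Q : Fm) → ⊢ (((s ∶ P) ∧' (t ∶ Q)) ⇒ ((s ⊗ t) ∶ (P ∧' Q)))
  pfact  : (t : Tm pos) (P : Fm) → ⊢ ((t ∶ P) ⇒ P)
  pintro : (t : Tm pos) (P : Fm) → ⊢ ((t ∶ P) ⇒ ((! t) ∶ (t ∶ P)))
  mp     : ∀ {A B} → ⊢ (A ⇒ B) → ⊢ A → ⊢ B

-- Truth of formulas given the two maps * : Var → {0,1} and * : Tm → P(Fm)
-- (the latter as characteristic function: P ∈ t* iff ev t P ≡ true).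
⟦_⟧[_,_] : Fm → (ℕ → Bool) → (∀ {σ} → Tm σ → Fm → Bool) → Bool
⟦ ⊥' ⟧[ V , ev ]     = false
⟦ var i ⟧[ V , ev ]  = V i
⟦ A ∧' B ⟧[ V , ev ] = ⟦ A ⟧[ V , ev ] ∧ ⟦ B ⟧[ V , ev ]
⟦ A ∨' B ⟧[ V , ev ] = ⟦ A ⟧[ V , ev ] ∨ ⟦ B ⟧[ V , ev ]
⟦ A ⇒ B ⟧[ V , ev ]  = not ⟦ A ⟧[ V , ev ] ∨ ⟦ B ⟧[ V , ev ]
⟦ ¬' A ⟧[ V , ev ]   = not ⟦ A ⟧[ V , ev ]
⟦ t ∶ A ⟧[ V , ev ]  = ev t A

record ModularModel : Set where
  field
    V   : ℕ → Bool
    ev  : ∀ {σ} → Tm σ → Fm → Bool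
    app-closed : ∀ {σ} (s t : Tm σ) (P Q : Fm) →
                 ev s (P ⇒ Q) ≡ true → ev t P ≡ true → ev (s · t) Q ≡ true
    sumˡ-closed : ∀ {σ} (s t : Tm σ) (P : Fm) → ev s P ≡ true → ev (s ⊕ t) P ≡ true
    sumʳ-closed : ∀ {σ} (s t : Tm σ) (P : Fm) → ev t P ≡ true → ev (s ⊕ t) P ≡ true
    pair-closed : (s t : Tm neg) (P Q : Fm) →
                  ev s P ≡ true → ev t Q ≡ true → ev (s ⊗ t) (P ∧' Q) ≡ true
    neg-false  : (t : Tm neg) (P : Fm) → ev t P ≡ true → ⟦ P ⟧[ V , ev ] ≡ false
    pos-true   : (t : Tm pos) (P : Fm) → ev t P ≡ true → ⟦ P ⟧[ V , ev ] ≡ true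
    bang       : (t : Tm pos) (P : Fm) → ev t P ≡ true → ev (! t) (t ∶ P) ≡ true

_⊨_ : ModularModel → Fm → Bool
M ⊨ A = ⟦ A ⟧[ ModularModel.V M , ModularModel.ev M ]

module Submission where

-- The canonical-model construction, made constructive. For a finite list Γ of formulas,
-- interpret each term t by the least finite list of formulas containing {P | t:P ∈ Γ} and
-- closed under the operations ·, +, ⊗ and ! of a modular model, and each propositional
-- variable by membership in Γ. This is a modular model as soon as every t:P ∈ Γ has P true
-- for positive t and false for negative t, a decidable condition.
--
-- Let H ⊬ φ contain A or ¬A for every subformula A of φ, and let Γ be the subformulas of φ
-- lying in H. By the truth lemma H derives A or ¬A according to the value of A in the model
-- of Γ, so consistency of H yields factivity and denial for Γ and the falsity of φ. Without a
-- decision procedure for derivability, Lindenbaum's lemma only gives such an H up to double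
-- negation; a search through the finitely many sublists of the subformulas of φ then
-- produces an actual model.

open import Defs
open import Data.Bool using (Bool; true; false; _∧_; _∨_; not; T)
open import Data.Bool.Properties using (T-∧; not-injective; not-¬) renaming (_≟_ to _≟ᵇ_)
open import Data.Empty using (⊥-elim)
open import Data.Nat using (ℕ; _≡ᵇ_)
open import Data.Nat.Properties using (≡ᵇ⇒≡; ≡⇒≡ᵇ)
open import Data.Product using (Σ; ∃; _×_; _,_; proj₁; proj₂; map₂)
open import Data.Sum using (inj₁; inj₂; [_,_]′)
open import Data.Unit using (⊤; tt)
open import Data.List using (List; []; _∷_; _++_; map; foldr; concatMap; filter; cartesianProductWith)
open import Data.List.Membership.Propositional using (_∈_; find; lose)
open import Data.List.Membership.Propositional.Properties
  using (∈-++⁺ˡ; ∈-++⁺ʳ; ∈-++⁻; ∈-map⁺; ∈-map⁻; ∈-filter⁺; ∈-filter⁻; ∈-concatMap⁺;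
         ∈-cartesianProductWith⁺; ∈-cartesianProductWith⁻)
open import Data.List.Relation.Unary.Any as Any using (here; there; any?)
open import Data.List.Relation.Unary.All as All using (All; []; _∷_)
open import Data.List.Relation.Unary.All.Properties using () renaming (map⁺ to All-map⁺; map⁻ to All-map⁻)
open import Data.List.Relation.Binary.Subset.Propositional using (_⊆_)
open import Data.List.Relation.Binary.Sublist.Propositional as Sublist using ([]; _∷_; _∷ʳ_)
open import Data.List.Relation.Binary.Sublist.Propositional.Properties using (filter-⊆)
open import Function using (_∘_; Equivalence)
open import Relation.Binary.Definitions using (DecidableEquality)
open import Relation.Binary.PropositionalEquality using (_≡_; refl; cong; cong₂; trans; subst)
open import Relation.Nullary using (¬_)
open import Relation.Nullary.Decidable using (Dec; yes; no; does; map′; T?; dec-true; dec-false; _×-dec_)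
open import Relation.Unary using (Decidable)

infix 4 _=ˢ_ _=ᵗ_ _=ᶠ_

_=ˢ_ : Sign → Sign → Bool
pos =ˢ pos = true
neg =ˢ neg = true
_   =ˢ _   = false

=ˢ⇒≡ : ∀ σ τ → T (σ =ˢ τ) → σ ≡ τ
=ˢ⇒≡ pos pos _ = refl
=ˢ⇒≡ neg neg _ = refl

=ˢ-refl : ∀ σ → T (σ =ˢ σ)
=ˢ-refl pos = tt
=ˢ-refl neg = tt

∧-split : ∀ a b → T (a ∧ b) → T a × T b
∧-split a b = Equivalence.to T-∧

∧-join : ∀ a b → T a → T b → T (a ∧ b)
∧-join a b p q = Equivalence.from T-∧ (p , q)

_=ᵗ_ : ∀ {σ τ} → Tm σ → Tm τ → Bool
_=ᵗ_ {σ} {τ} (con m)  (con n)  = (σ =ˢ τ) ∧ (m ≡ᵇ n)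
_=ᵗ_ {σ} {τ} (tvar m) (tvar n) = (σ =ˢ τ) ∧ (m ≡ᵇ n)
(s ⊕ t) =ᵗ (s′ ⊕ t′) = (s =ᵗ s′) ∧ (t =ᵗ t′)
(s · t) =ᵗ (s′ · t′) = (s =ᵗ s′) ∧ (t =ᵗ t′)
(s ⊗ t) =ᵗ (s′ ⊗ t′) = (s =ᵗ s′) ∧ (t =ᵗ t′)
(! t)   =ᵗ (! t′)    = t =ᵗ t′
_       =ᵗ _         = false

=ᵗ⇒≡ : ∀ {σ τ} (s : Tm σ) (t : Tm τ) → T (s =ᵗ t) → _≡_ {A = Σ Sign Tm} (σ , s) (τ , t)
=ᵗ⇒≡ {σ} {τ} (con m) (con n) eq
  with refl ← =ˢ⇒≡ σ τ (proj₁ (∧-split (σ =ˢ τ) _ eq))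
     | refl ← ≡ᵇ⇒≡ m n (proj₂ (∧-split (σ =ˢ τ) _ eq)) = refl
=ᵗ⇒≡ {σ} {τ} (tvar m) (tvar n) eq
  with refl ← =ˢ⇒≡ σ τ (proj₁ (∧-split (σ =ˢ τ) _ eq))
     | refl ← ≡ᵇ⇒≡ m n (proj₂ (∧-split (σ =ˢ τ) _ eq)) = refl
=ᵗ⇒≡ (s ⊕ t) (s′ ⊕ t′) eq
  with refl ← =ᵗ⇒≡ s s′ (proj₁ (∧-split (s =ᵗ s′) _ eq))
     | refl ← =ᵗ⇒≡ t t′ (proj₂ (∧-split (s =ᵗ s′) _ eq)) = refl
=ᵗ⇒≡ (s · t) (s′ · t′) eq
  with refl ← =ᵗ⇒≡ s s′ (proj₁ (∧-split (s =ᵗ s′) _ eq))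
     | refl ← =ᵗ⇒≡ t t′ (proj₂ (∧-split (s =ᵗ s′) _ eq)) = refl
=ᵗ⇒≡ (s ⊗ t) (s′ ⊗ t′) eq
  with refl ← =ᵗ⇒≡ s s′ (proj₁ (∧-split (s =ᵗ s′) _ eq))
     | refl ← =ᵗ⇒≡ t t′ (proj₂ (∧-split (s =ᵗ s′) _ eq)) = refl
=ᵗ⇒≡ (! t) (! t′) eq with refl ← =ᵗ⇒≡ t t′ eq = refl

=ᵗ-refl : ∀ {σ} (t : Tm σ) → T (t =ᵗ t)
=ᵗ-refl {σ} (con n)  = ∧-join (σ =ˢ σ) _ (=ˢ-refl σ) (≡⇒≡ᵇ n n refl)
=ᵗ-refl {σ} (tvar n) = ∧-join (σ =ˢ σ) _ (=ˢ-refl σ) (≡⇒≡ᵇ n n refl)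
=ᵗ-refl (s ⊕ t) = ∧-join (s =ᵗ s) _ (=ᵗ-refl s) (=ᵗ-refl t)
=ᵗ-refl (s · t) = ∧-join (s =ᵗ s) _ (=ᵗ-refl s) (=ᵗ-refl t)
=ᵗ-refl (s ⊗ t) = ∧-join (s =ᵗ s) _ (=ᵗ-refl s) (=ᵗ-refl t)
=ᵗ-refl (! t)   = =ᵗ-refl t

_=ᶠ_ : Fm → Fm → Bool
⊥'       =ᶠ ⊥'         = true
var i    =ᶠ var j      = i ≡ᵇ j
(A ∧' B) =ᶠ (A′ ∧' B′) = (A =ᶠ A′) ∧ (B =ᶠ B′)
(A ∨' B) =ᶠ (A′ ∨' B′) = (A =ᶠ A′) ∧ (B =ᶠ B′)
(A ⇒ B)  =ᶠ (A′ ⇒ B′)  = (A =ᶠ A′) ∧ (B =ᶠ B′)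
(¬' A)   =ᶠ (¬' A′)    = A =ᶠ A′
(s ∶ A)  =ᶠ (t ∶ A′)   = (s =ᵗ t) ∧ (A =ᶠ A′)
_        =ᶠ _          = false

=ᶠ⇒≡ : ∀ A B → T (A =ᶠ B) → A ≡ B
=ᶠ⇒≡ ⊥' ⊥' _ = refl
=ᶠ⇒≡ (var i) (var j) eq = cong var (≡ᵇ⇒≡ i j eq)
=ᶠ⇒≡ (A ∧' B) (A′ ∧' B′) eq
  with refl ← =ᶠ⇒≡ A A′ (proj₁ (∧-split (A =ᶠ A′) _ eq))
     | refl ← =ᶠ⇒≡ B B′ (proj₂ (∧-split (A =ᶠ A′) _ eq)) = refl
=ᶠ⇒≡ (A ∨' B) (A′ ∨' B′) eq
  with refl ← =ᶠ⇒≡ A A′ (proj₁ (∧-split (A =ᶠ A′) _ eq))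
     | refl ← =ᶠ⇒≡ B B′ (proj₂ (∧-split (A =ᶠ A′) _ eq)) = refl
=ᶠ⇒≡ (A ⇒ B) (A′ ⇒ B′) eq
  with refl ← =ᶠ⇒≡ A A′ (proj₁ (∧-split (A =ᶠ A′) _ eq))
     | refl ← =ᶠ⇒≡ B B′ (proj₂ (∧-split (A =ᶠ A′) _ eq)) = refl
=ᶠ⇒≡ (¬' A) (¬' A′) eq = cong ¬'_ (=ᶠ⇒≡ A A′ eq)
=ᶠ⇒≡ (s ∶ A) (t ∶ A′) eq
  with refl ← =ᵗ⇒≡ s t (proj₁ (∧-split (s =ᵗ t) _ eq))
     | refl ← =ᶠ⇒≡ A A′ (proj₂ (∧-split (s =ᵗ t) _ eq)) = refl

=ᶠ-refl : ∀ A → T (A =ᶠ A)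
=ᶠ-refl ⊥'       = tt
=ᶠ-refl (var i)  = ≡⇒≡ᵇ i i refl
=ᶠ-refl (A ∧' B) = ∧-join (A =ᶠ A) _ (=ᶠ-refl A) (=ᶠ-refl B)
=ᶠ-refl (A ∨' B) = ∧-join (A =ᶠ A) _ (=ᶠ-refl A) (=ᶠ-refl B)
=ᶠ-refl (A ⇒ B)  = ∧-join (A =ᶠ A) _ (=ᶠ-refl A) (=ᶠ-refl B)
=ᶠ-refl (¬' A)   = =ᶠ-refl A
=ᶠ-refl (s ∶ A)  = ∧-join (s =ᵗ s) _ (=ᵗ-refl s) (=ᶠ-refl A)

_≟_ : DecidableEquality Fm
A ≟ B = map′ (=ᶠ⇒≡ A B) (λ { refl → =ᶠ-refl A }) (T? (A =ᶠ B))

subformulas strictSubformulas : Fm → List Fm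
subformulas A = A ∷ strictSubformulas A
strictSubformulas ⊥'       = []
strictSubformulas (var i)  = []
strictSubformulas (A ∧' B) = subformulas A ++ subformulas B
strictSubformulas (A ∨' B) = subformulas A ++ subformulas B
strictSubformulas (A ⇒ B)  = subformulas A ++ subformulas B
strictSubformulas (¬' A)   = subformulas A
strictSubformulas (t ∶ A)  = subformulas A

subformulas-closed : ∀ B {A} → A ∈ subformulas B → subformulas A ⊆ subformulas B
strictSubformulas-closed : ∀ B {A} → A ∈ strictSubformulas B → subformulas A ⊆ strictSubformulas B
subformulas-++-closed : ∀ B C {A} → A ∈ subformulas B ++ subformulas C →
                        subformulas A ⊆ subformulas B ++ subformulas C

subformulas-closed B (here refl) = λ p → p
subformulas-closed B (there p)   = there ∘ strictSubformulas-closed B p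

strictSubformulas-closed (B ∧' C) = subformulas-++-closed B C
strictSubformulas-closed (B ∨' C) = subformulas-++-closed B C
strictSubformulas-closed (B ⇒ C)  = subformulas-++-closed B C
strictSubformulas-closed (¬' B)   = subformulas-closed B
strictSubformulas-closed (t ∶ B)  = subformulas-closed B

subformulas-++-closed B C p with ∈-++⁻ (subformulas B) p
... | inj₁ q = ∈-++⁺ˡ ∘ subformulas-closed B q
... | inj₂ q = ∈-++⁺ʳ (subformulas B) ∘ subformulas-closed C q

sublists : ∀ {a} {X : Set a} → List X → List (List X)
sublists []       = [] ∷ []
sublists (x ∷ xs) = map (x ∷_) (sublists xs) ++ sublists xs

∈-sublists : ∀ {a} {X : Set a} {xs ys : List X} → ys Sublist.⊆ xs → ys ∈ sublists xs
∈-sublists []          = here refl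
∈-sublists (x ∷ʳ p)    = ∈-++⁺ʳ _ (∈-sublists p)
∈-sublists (refl ∷ p)  = ∈-++⁺ˡ (∈-map⁺ _ (∈-sublists p))

Holds : (Fm → Bool) → Fm → Set
Holds v A = evalP v A ≡ true

⇒ᵇ-intro : ∀ {a b} → (a ≡ true → b ≡ true) → not a ∨ b ≡ true
⇒ᵇ-intro {false} _ = refl
⇒ᵇ-intro {true}  h = h refl

⇒ᵇ-elim : ∀ {a b} → not a ∨ b ≡ true → a ≡ true → b ≡ true
⇒ᵇ-elim h refl = h

infixr 5 _⟹_
infix 3 _⊢ʰ_ _⊬_

_⟹_ : List Fm → Fm → Fm
H ⟹ A = foldr _⇒_ A H

-- Records rather than type synonyms, so that H and A stay inferable.
record _⊢ʰ_ (H : List Fm) (A : Fm) : Set where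
  constructor derive
  field derivation : ⊢ (H ⟹ A)
open _⊢ʰ_

_⊬_ : List Fm → Fm → Set
H ⊬ A = ¬ (H ⊢ʰ A)

⟹-intro : ∀ {v A} H → (All (Holds v) H → Holds v A) → Holds v (H ⟹ A)
⟹-intro []      h = h []
⟹-intro (B ∷ H) h = ⇒ᵇ-intro λ b → ⟹-intro H (h ∘ (b ∷_))

⟹-elim : ∀ {v A} H → Holds v (H ⟹ A) → All (Holds v) H → Holds v A
⟹-elim []      h []       = h
⟹-elim (B ∷ H) h (b ∷ bs) = ⟹-elim H (⇒ᵇ-elim h b) bs

mp* : ∀ {Bs A} → ⊢ (Bs ⟹ A) → All ⊢_ Bs → ⊢ A
mp* d []       = d
mp* d (e ∷ es) = mp* (mp d e) es

tautological : ∀ {H As A} → (∀ v → All (Holds v) H → All (Holds v) As → Holds v A) →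
               All (H ⊢ʰ_) As → H ⊢ʰ A
tautological {H} {As} h ds = derive (mp* (taut λ v →
  ⟹-intro (map (H ⟹_) As) λ hs → ⟹-intro H λ hH →
  h v hH (All.map (λ hA → ⟹-elim H hA hH) (All-map⁻ hs))) (All-map⁺ (All.map derivation ds)))

hypʰ : ∀ {H A} → A ∈ H → H ⊢ʰ A
hypʰ A∈H = tautological (λ _ hH _ → All.lookup hH A∈H) []

mpʰ : ∀ {H A B} → H ⊢ʰ (A ⇒ B) → H ⊢ʰ A → H ⊢ʰ B
mpʰ d e = tautological (λ { _ _ (f ∷ a ∷ []) → ⇒ᵇ-elim f a }) (d ∷ e ∷ [])

axiomʰ : ∀ {H A} → ⊢ A → H ⊢ʰ A
axiomʰ {H} d = derive (mp (taut λ v → ⇒ᵇ-intro λ a → ⟹-intro H λ _ → a) d)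

lit : Bool → Fm → Fm
lit true  A = A
lit false A = ¬' A

lit-holds : ∀ b {v A} → Holds v (lit b A) → evalP v A ≡ b
lit-holds true  h = h
lit-holds false h = not-injective h

holds-lit : ∀ b {v A} → evalP v A ≡ b → Holds v (lit b A)
holds-lit true  e = e
holds-lit false e = cong not e

record Decides (H : List Fm) (A : Fm) (b : Bool) : Set where
  constructor decides
  field decision : H ⊢ʰ lit b A

decides-compose₁ : ∀ (op : Bool → Bool) {H A C a} → (∀ v → evalP v C ≡ op (evalP v A)) →
                   Decides H A a → Decides H C (op a)
decides-compose₁ op {a = a} hom (decides d) = decides (tautological
  (λ { v _ (h ∷ []) → holds-lit (op a) (trans (hom v) (cong op (lit-holds a h))) })
  (d ∷ []))

decides-compose₂ : ∀ (op : Bool → Bool → Bool) {H A B C a b} →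
                   (∀ v → evalP v C ≡ op (evalP v A) (evalP v B)) →
                   Decides H A a → Decides H B b → Decides H C (op a b)
decides-compose₂ op {a = a} {b} hom (decides d) (decides e) = decides (tautological
  (λ { v _ (h ∷ h′ ∷ []) →
        holds-lit (op a b) (trans (hom v) (cong₂ op (lit-holds a h) (lit-holds b h′))) })
  (d ∷ e ∷ []))

explosion : ∀ {H A B} → H ⊢ʰ A → H ⊢ʰ ¬' A → H ⊢ʰ B
explosion {A = A} d e = tautological
  (λ { v _ (h ∷ h′ ∷ []) → ⊥-elim (not-¬ h (lit-holds false {v} {A} h′)) })
  (d ∷ e ∷ [])

decides-unique : ∀ {H A B a b} → Decides H A a → Decides H A b → H ⊬ B → a ≡ b
decides-unique {a = true}  {true}  _ _ _ = refl
decides-unique {a = false} {false} _ _ _ = refl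
decides-unique {a = true}  {false} (decides d) (decides e) H⊬B = ⊥-elim (H⊬B (explosion d e))
decides-unique {a = false} {true}  (decides d) (decides e) H⊬B = ⊥-elim (H⊬B (explosion e d))

⇒ᵇ-cases : ∀ a {c} → not a ∨ c ≡ true → not (not a) ∨ c ≡ true → c ≡ true
⇒ᵇ-cases true  h _ = h
⇒ᵇ-cases false _ h = h

-- (x ∷ H) ⟹ A is x ⇒ (H ⟹ A), so the case split is a tautology without hypotheses.
excluded-middle : ∀ {H x A} → (x ∷ H) ⊢ʰ A → (¬' x ∷ H) ⊢ʰ A → H ⊢ʰ A
excluded-middle {x = x} (derive d) (derive e) = derive (derivation (tautological {[]}
  (λ { v _ (h ∷ h′ ∷ []) → ⇒ᵇ-cases (evalP v x) h h′ })
  (derive d ∷ derive e ∷ [])))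

CompleteFor : List Fm → List Fm → Set
CompleteFor S H = ∀ {A} → A ∈ S → ∃ λ b → lit b A ∈ H

CompleteFor-∷ : ∀ b {x S H} → CompleteFor S H → CompleteFor (x ∷ S) (lit b x ∷ H)
CompleteFor-∷ b complete (here refl) = b , here refl
CompleteFor-∷ b complete (there p)   = map₂ there (complete p)

lindenbaum : ∀ S {φ} → [] ⊬ φ → ¬ ¬ (∃ λ H → CompleteFor S H × H ⊬ φ)
lindenbaum []      ⊬φ k = k ([] , (λ ()) , ⊬φ)
lindenbaum (x ∷ S) ⊬φ k = lindenbaum S ⊬φ λ (H , complete , H⊬φ) →
  k (¬' x ∷ H , CompleteFor-∷ false complete , λ ⊢¬x →
  k (x ∷ H , CompleteFor-∷ true complete , λ ⊢x →
  H⊬φ (excluded-middle ⊢x ⊢¬x)))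

open import Data.List.Membership.DecPropositional _≟_ using (_∈?_)

does-true⇒ : ∀ {X : Set} (d : Dec X) → does d ≡ true → X
does-true⇒ (yes x) _ = x

allSubformulas : List Fm → List Fm
allSubformulas = concatMap subformulas

∈-allSubformulas : ∀ {A B xs} → A ∈ subformulas B → B ∈ xs → A ∈ allSubformulas xs
∈-allSubformulas A∈B B∈xs = ∈-concatMap⁺ subformulas (Any.map (λ { refl → A∈B }) B∈xs)

infixl 7 _·ˢ_

-- The paper's X · Y; its elements are sought among the subformulas of X to keep it finite.

detached? : ∀ xs ys → Decidable (λ B → Any.Any (λ A → (A ⇒ B) ∈ xs) ys)
detached? xs ys B = any? (λ A → (A ⇒ B) ∈? xs) ys

_·ˢ_ : List Fm → List Fm → List Fm
xs ·ˢ ys = filter (detached? xs ys) (allSubformulas xs)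

∈-·ˢ⁺ : ∀ {A B xs ys} → (A ⇒ B) ∈ xs → A ∈ ys → B ∈ xs ·ˢ ys
∈-·ˢ⁺ {A} {xs = xs} {ys} A⇒B∈xs A∈ys = ∈-filter⁺ (detached? xs ys)
  (∈-allSubformulas (there (∈-++⁺ʳ (subformulas A) (here refl))) A⇒B∈xs)
  (lose A∈ys A⇒B∈xs)

∈-·ˢ⁻ : ∀ {B xs ys} → B ∈ xs ·ˢ ys → ∃ λ A → (A ⇒ B) ∈ xs × A ∈ ys
∈-·ˢ⁻ {xs = xs} {ys} p
  with A , A∈ys , A⇒B∈xs ← find (proj₂ (∈-filter⁻ (detached? xs ys) {xs = allSubformulas xs} p)) =
  A , A⇒B∈xs , A∈ys

expected : Sign → Bool
expected pos = true
expected neg = false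

expected-mp : ∀ σ {a b} → not a ∨ b ≡ expected σ → a ≡ expected σ → b ≡ expected σ
expected-mp pos e refl = e

module Canonical (Γ : List Fm) where

  asserted? : ∀ {σ} (t : Tm σ) → Decidable (λ P → (t ∶ P) ∈ Γ)
  asserted? t P = (t ∶ P) ∈? Γ

  asserted : ∀ {σ} → Tm σ → List Fm
  asserted t = filter (asserted? t) (allSubformulas Γ)

  ∈-asserted⁺ : ∀ {σ} {t : Tm σ} {P} → (t ∶ P) ∈ Γ → P ∈ asserted t
  ∈-asserted⁺ {t = t} t∶P∈Γ =
    ∈-filter⁺ (asserted? t) (∈-allSubformulas (there (here refl)) t∶P∈Γ) t∶P∈Γ

  ∈-asserted⁻ : ∀ {σ} {t : Tm σ} {P} → P ∈ asserted t → (t ∶ P) ∈ Γ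
  ∈-asserted⁻ {t = t} = proj₂ ∘ ∈-filter⁻ (asserted? t) {xs = allSubformulas Γ}

  closure generated : ∀ {σ} → Tm σ → List Fm
  closure t = asserted t ++ generated t
  generated (con _)  = []
  generated (tvar _) = []
  generated (s ⊕ t)  = closure s ++ closure t
  generated (s · t)  = closure s ·ˢ closure t
  generated (s ⊗ t)  = cartesianProductWith _∧'_ (closure s) (closure t)
  generated (! t)    = map (t ∶_) (closure t)

  V : ℕ → Bool
  V i = does (var i ∈? Γ)

  ev : ∀ {σ} → Tm σ → Fm → Bool
  ev t P = does (P ∈? closure t)

  ⟦_⟧ : Fm → Bool
  ⟦ A ⟧ = ⟦ A ⟧[ V , ev ]

  Faithful : Fm → Set
  Faithful (_∶_ {σ} t P) = ⟦ P ⟧ ≡ expected σ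
  Faithful _             = ⊤

  faithful? : Decidable Faithful
  faithful? (_∶_ {σ} t P) = ⟦ P ⟧ ≟ᵇ expected σ
  faithful? ⊥'            = yes tt
  faithful? (var _)       = yes tt
  faithful? (_ ∧' _)      = yes tt
  faithful? (_ ∨' _)      = yes tt
  faithful? (_ ⇒ _)       = yes tt
  faithful? (¬' _)        = yes tt

  module _ (faithful : All Faithful Γ) where

    closure-faithful   : ∀ {σ} (t : Tm σ) {P} → P ∈ closure t   → ⟦ P ⟧ ≡ expected σ
    generated-faithful : ∀ {σ} (t : Tm σ) {P} → P ∈ generated t → ⟦ P ⟧ ≡ expected σ
    closure-faithful t p =
      [ All.lookup faithful ∘ ∈-asserted⁻ , generated-faithful t ]′ (∈-++⁻ (asserted t) p)
    generated-faithful (s ⊕ t) p =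
      [ closure-faithful s , closure-faithful t ]′ (∈-++⁻ (closure s) p)
    generated-faithful (_·_ {σ} s t) p with A , A⇒P∈ , A∈ ← ∈-·ˢ⁻ p =
      expected-mp σ (closure-faithful s A⇒P∈) (closure-faithful t A∈)
    generated-faithful (s ⊗ t) p
      with A , B , A∈ , B∈ , refl ← ∈-cartesianProductWith⁻ _∧'_ (closure s) (closure t) p =
      cong (_∧ ⟦ B ⟧) (closure-faithful s A∈)
    generated-faithful (! t) p with B , B∈ , refl ← ∈-map⁻ (t ∶_) p =
      dec-true (B ∈? closure t) B∈

    model : ModularModel
    model = record
      { V = V
      ; ev = ev
      ; app-closed  = λ s t P Q s⊢ t⊢ → closed (s · t) (∈-·ˢ⁺ (∈ev s⊢) (∈ev t⊢))
      ; sumˡ-closed = λ s t P s⊢ → closed (s ⊕ t) (∈-++⁺ˡ (∈ev s⊢))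
      ; sumʳ-closed = λ s t P t⊢ → closed (s ⊕ t) (∈-++⁺ʳ (closure s) (∈ev t⊢))
      ; pair-closed = λ s t P Q s⊢ t⊢ →
          closed (s ⊗ t) (∈-cartesianProductWith⁺ _∧'_ (∈ev s⊢) (∈ev t⊢))
      ; neg-false = λ t P t⊢ → closure-faithful t (∈ev t⊢)
      ; pos-true  = λ t P t⊢ → closure-faithful t (∈ev t⊢)
      ; bang = λ t P t⊢ → closed (! t) (∈-map⁺ (t ∶_) (∈ev t⊢))
      }
      where
      ∈ev : ∀ {σ} {t : Tm σ} {P} → ev t P ≡ true → P ∈ closure t
      ∈ev {t = t} {P} = does-true⇒ (P ∈? closure t)
      closed : ∀ {σ} (t : Tm σ) {P} → P ∈ generated t → ev t P ≡ true
      closed t {P} p = dec-true (P ∈? closure t) (∈-++⁺ʳ (asserted t) p)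

  Refutes : Fm → Set
  Refutes φ = All Faithful Γ × ⟦ φ ⟧ ≡ false

  refutes? : Decidable Refutes
  refutes? φ = All.all? faithful? Γ ×-dec (⟦ φ ⟧ ≟ᵇ false)

  module _ {H} (Γ⊆H : Γ ⊆ H) where

    closure-derivable   : ∀ {σ} (t : Tm σ) {P} → P ∈ closure t   → H ⊢ʰ (t ∶ P)
    generated-derivable : ∀ {σ} (t : Tm σ) {P} → P ∈ generated t → H ⊢ʰ (t ∶ P)
    closure-derivable t p =
      [ hypʰ ∘ Γ⊆H ∘ ∈-asserted⁻ , generated-derivable t ]′ (∈-++⁻ (asserted t) p)
    generated-derivable (s ⊕ t) p =
      [ mpʰ (axiomʰ (sumˡ s t _)) ∘ closure-derivable s
      , mpʰ (axiomʰ (sumʳ s t _)) ∘ closure-derivable t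
      ]′ (∈-++⁻ (closure s) p)
    generated-derivable (s · t) p with A , A⇒P∈ , A∈ ← ∈-·ˢ⁻ p =
      mpʰ (mpʰ (axiomʰ (appl s t A _)) (closure-derivable s A⇒P∈)) (closure-derivable t A∈)
    generated-derivable (s ⊗ t) p
      with A , B , A∈ , B∈ , refl ← ∈-cartesianProductWith⁻ _∧'_ (closure s) (closure t) p =
      mpʰ (axiomʰ (pairing s t A B))
          (tautological (λ { _ _ (a ∷ b ∷ []) → cong₂ _∧_ a b })
                        (closure-derivable s A∈ ∷ closure-derivable t B∈ ∷ []))
    generated-derivable (! t) p with B , B∈ , refl ← ∈-map⁻ (t ∶_) p =
      mpʰ (axiomʰ (pintro t B)) (closure-derivable t B∈)

justification-decides : ∀ {σ H} (u : Tm σ) P → H ⊢ʰ (u ∶ P) → Decides H P (expected σ)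
justification-decides {pos} u P = decides ∘ mpʰ (axiomʰ (pfact u P))
justification-decides {neg} u P = decides ∘ mpʰ (axiomʰ (denial u P))

module TruthLemma {φ H} (complete : CompleteFor (subformulas φ) H) where

  S Γ : List Fm
  S = subformulas φ
  Γ = filter (_∈? H) S

  open Canonical Γ

  Γ⊆S : Γ ⊆ S
  Γ⊆S = proj₁ ∘ ∈-filter⁻ (_∈? H) {xs = S}

  Γ⊆H : Γ ⊆ H
  Γ⊆H = proj₂ ∘ ∈-filter⁻ (_∈? H) {xs = S}

  decided : ∀ {A} → A ∈ S → Decides H A (does (A ∈? Γ))
  decided {A} A∈S with A ∈? Γ | complete A∈S
  ... | yes A∈Γ | _            = decides (hypʰ (Γ⊆H A∈Γ))
  ... | no  A∉Γ | true  , A∈H  = ⊥-elim (A∉Γ (∈-filter⁺ (_∈? H) A∈S A∈H))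
  ... | no  _   | false , ¬A∈H = decides (hypʰ ¬A∈H)

  justification : ∀ {σ} (t : Tm σ) {A} → (t ∶ A) ∈ S → Decides H (t ∶ A) (does (A ∈? closure t))
  justification t {A} t∶A∈S with A ∈? closure t
  ... | yes A∈ = decides (closure-derivable Γ⊆H t A∈)
  ... | no  A∉ = subst (Decides H (t ∶ A))
                       (dec-false ((t ∶ A) ∈? Γ) (A∉ ∘ ∈-++⁺ˡ ∘ ∈-asserted⁺))
                       (decided t∶A∈S)

  truth : ∀ A → subformulas A ⊆ S → Decides H A ⟦ A ⟧
  truth ⊥'       _   = decides (tautological (λ _ _ _ → refl) [])
  truth (var i)  sub = decided (sub (here refl))
  truth (A ∧' B) sub = decides-compose₂ _∧_ (λ _ → refl)
    (truth A (sub ∘ there ∘ ∈-++⁺ˡ)) (truth B (sub ∘ there ∘ ∈-++⁺ʳ (subformulas A)))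
  truth (A ∨' B) sub = decides-compose₂ _∨_ (λ _ → refl)
    (truth A (sub ∘ there ∘ ∈-++⁺ˡ)) (truth B (sub ∘ there ∘ ∈-++⁺ʳ (subformulas A)))
  truth (A ⇒ B)  sub = decides-compose₂ (λ a b → not a ∨ b) (λ _ → refl)
    (truth A (sub ∘ there ∘ ∈-++⁺ˡ)) (truth B (sub ∘ there ∘ ∈-++⁺ʳ (subformulas A)))
  truth (¬' A)   sub = decides-compose₁ not (λ _ → refl) (truth A (sub ∘ there))
  truth (t ∶ A)  sub = justification t (sub (here refl))

  module _ (H⊬φ : H ⊬ φ) where

    faithful-member : ∀ A → A ∈ S → A ∈ H → Faithful A
    faithful-member (_∶_ {σ} u P) u∶P∈S u∶P∈H =
      decides-unique (truth P (subformulas-closed φ u∶P∈S ∘ there))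
                     (justification-decides u P (hypʰ u∶P∈H))
                     H⊬φ
    faithful-member ⊥'       _ _ = tt
    faithful-member (var _)  _ _ = tt
    faithful-member (_ ∧' _) _ _ = tt
    faithful-member (_ ∨' _) _ _ = tt
    faithful-member (_ ⇒ _)  _ _ = tt
    faithful-member (¬' _)   _ _ = tt

    refutes : Refutes φ
    refutes = All.tabulate (λ A∈Γ → faithful-member _ (Γ⊆S A∈Γ) (Γ⊆H A∈Γ)) , refuted
      where
      refuted : ⟦ φ ⟧ ≡ false
      refuted with ⟦ φ ⟧ | truth φ (λ p → p)
      ... | true  | decides ⊢φ = ⊥-elim (H⊬φ ⊢φ)
      ... | false | _          = refl

theorem4p2 : (φ : Fm) → ¬ (⊢ φ) → ∃ λ (M : ModularModel) → (M ⊨ φ) ≡ false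
theorem4p2 φ ⊬φ with any? (λ Γ → Canonical.refutes? Γ φ) (sublists (subformulas φ))
... | yes found with Γ , faithful , refuted ← Any.satisfied found =
  Canonical.model Γ faithful , refuted
... | no none = ⊥-elim (lindenbaum (subformulas φ) (⊬φ ∘ derivation) λ (H , complete , H⊬φ) →
  none (lose (∈-sublists (filter-⊆ (_∈? H) (subformulas φ))) (TruthLemma.refutes complete H⊬φ)))
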